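{- Let $F$ be a tract and $\varphi:\mathcal T_n\cup\mathcal A_n\to F$ a restricted Grassmann--Plücker function. Let $S$ be a hyper-transversal containing the skew pair $\{i,i^*\}$ and let $S'=S\setminus\{i,i^*\}$ (a hypo-transversal). Define $X_S(k)=(-1)^{|S<k|}\varphi(S\setminus\{k\})$ for $k\in S$ and $X_S(k)=0$ otherwise, and $Y_{S'}(k)=(-1)^{|S'<k^*|}\varphi(S'\cup\{k^*\})$ for $k\notin(S')^*$ and $Y_{S'}(k)=0$ otherwise. Then $Y_{S'}=X_S$ or $Y_{S'}=-X_S$.
   Context: Tract: monoid $F=F^\times\sqcup\{0\}$ with null set $N_F$ of formal sums, $F\cap N_F=\{0\}$, unique $-1$ with $1+(-1)\in N_F$, $N_F$ closed under $F^\times$-scaling. Notation: $[n]^*=\{1^*,\dots,n^*\}$, $(k^*)^*=k$, $S^*=\{s^*:s\in S\}$; order $1<1^*<\dots<n<n^*$; $|X<k|$ = number of elements of $X$ smaller than $k$; $[P]$ indicator. $\mathcal T_n$: transversals (exactly one of $i,i^*$ for each $i$); $\mathcal T_n^\sigma$: $|T\cap[n]^*|\equiv\sigma\pmod2$; $\mathcal A_n$: $n$-subsets with exactly one pair $\{i,i^*\}$; hyper-/hypo-transversal: transversal with one element added/removed. Restricted Grassmann--Plücker function: $\varphi:\mathcal T_n\cup\mathcal A_n\to F$, not identically zero, with (rGP2) $\sum_{i\in S\setminus S'}(-1)^{|S\triangle S'<i|}\varphi(S\setminus\{i\})\varphi(S'\cup\{i\})\in N_F$ for every hyper-transversal $S$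 and hypo-transversal $S'$; (rGP3) some $\sigma\in\{0,1\}$ with $\varphi=0$ on $\mathcal T_n^{1-\sigma}$; (rGP4) $\varphi((B\setminus\{i,i^*\})\cup\{j,j^*\})=(-1)^{[i\in B]+[j\in B]}\varphi((B\cup\{i,i^*\})\setminus\{j,j^*\})$ for $B\in\mathcal T_n^\sigma$, distinct $i,j\in[n]$. -}

module Defs where

open import Data.Nat using (ℕ; zero; suc; _+_; _<ᵇ_; _≡ᵇ_)
open import Data.Bool using (Bool; true; false; not; _∧_; _∨_; if_then_else_; _xor_)
open import Data.Fin using (Fin; toℕ)
open import Data.Product using (Σ; _×_; _,_; proj₁; proj₂; ∃; ∃-syntax)
open import Data.List using (List; []; _∷_; map; concatMap; filterᵇ)
open import Data.Nat.ListAction using (sum)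
open import Data.List.Relation.Binary.Permutation.Propositional using (_↭_)
open import Data.Vec using (Vec; lookup; updateAt; zipWith; allFin; toList; countᵇ)
open import Relation.Binary.PropositionalEquality using (_≡_; _≢_)
open import Relation.Nullary using (¬_)
open import Function.Bundles using (_⇔_)
open import Data.Sum using (_⊎_)

-- Formal sums of elements
-- of F are represented by lists (order irrelevant: N is invariant
-- under permutation; 0 is the empty formal sum: N ignores 0 terms).

record Tract : Set₁ where
  field
    Carrier  : Set
    _·_      : Carrier → Carrier → Carrier
    one      : Carrier
    zero#    : Carrier
    ·-assoc  : ∀ x y z → (x · y) · z ≡ x · (y · z)
    ·-comm   : ∀ x y → x · y ≡ y · x
    ·-identityˡ : ∀ x → one · x ≡ x
    ·-zeroˡ  : ∀ x → zero# · x ≡ zero#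
    one≢zero : one ≢ zero#
    ·-inverse : ∀ x → x ≢ zero# → ∃[ y ] (x · y ≡ one)
    N        : List Carrier → Set
    N-perm   : ∀ {xs ys} → xs ↭ ys → N xs → N ys
    N-zero   : ∀ xs → N (zero# ∷ xs) ⇔ N xs
    N-empty  : N []
    N-single : ∀ x → N (x ∷ []) → x ≡ zero#
    minus1   : Carrier
    N-minus1 : N (one ∷ minus1 ∷ [])
    minus1-unique : ∀ x → N (one ∷ x ∷ []) → x ≡ minus1
    N-scale  : ∀ a xs → a ≢ zero# → N xs → N (map (a ·_) xs)

-- Ground set [n] ⊔ [n]^*.  An element is (i , b) with i : Fin n and
-- b = true meaning the starred element i^*.  A subset is recorded, for
-- each i, by the pair (i ∈ X , i^* ∈ X).

Elem : ℕ → Set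
Elem n = Fin n × Bool

Sub : ℕ → Set
Sub n = Vec (Bool × Bool) n

star : ∀ {n} → Elem n → Elem n
star (i , b) = (i , not b)

mem : ∀ {n} → Sub n → Elem n → Bool
mem X (i , false) = proj₁ (lookup X i)
mem X (i , true)  = proj₂ (lookup X i)

setBit : Bool → Bool → Bool × Bool → Bool × Bool
setBit false v (a , b) = (v , b)
setBit true  v (a , b) = (a , v)

ins : ∀ {n} → Elem n → Sub n → Sub n
ins (i , b) X = updateAt X i (setBit b true)

del : ∀ {n} → Elem n → Sub n → Sub n
del (i , b) X = updateAt X i (setBit b false)

allElems : ∀ n → List (Elem n)
allElems n = concatMap (λ i → (i , false) ∷ (i , true) ∷ []) (toList (allFin n))

_<E_ : ∀ {n} → Elem n → Elem n → Bool
(i , b) <E (j , c) = (toℕ i <ᵇ toℕ j) ∨ ((toℕ i ≡ᵇ toℕ j) ∧ (not b ∧ c))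

countBelow : ∀ {n} → Sub n → Elem n → ℕ
countBelow {n} X k = sum (map (λ x → if mem X x ∧ (x <E k) then 1 else 0) (allElems n))

elems : ∀ {n} → Sub n → List (Elem n)
elems {n} X = filterᵇ (mem X) (allElems n)

_△_ : ∀ {n} → Sub n → Sub n → Sub n
X △ Y = zipWith (λ p q → (proj₁ p xor proj₁ q , proj₂ p xor proj₂ q)) X Y

_∖_ : ∀ {n} → Sub n → Sub n → Sub n
X ∖ Y = zipWith (λ p q → (proj₁ p ∧ not (proj₁ q) , proj₂ p ∧ not (proj₂ q))) X Y

size : ∀ {n} → Sub n → ℕ
size X = sum (map (λ p → (if proj₁ p then 1 else 0) + (if proj₂ p then 1 else 0)) (toList X))

pairCount : ∀ {n} → Sub n → Fin n → ℕ
pairCount X i = (if proj₁ (lookup X i) then 1 else 0) + (if proj₂ (lookup X i) then 1 else 0)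

IsTransversal : ∀ {n} → Sub n → Set
IsTransversal X = ∀ i → pairCount X i ≡ 1

IsHyperTransversal : ∀ {n} → Sub n → Set
IsHyperTransversal {n} S =
  Σ (Sub n) λ T → Σ (Elem n) λ x → IsTransversal T × mem T x ≡ false × S ≡ ins x T

IsHypoTransversal : ∀ {n} → Sub n → Set
IsHypoTransversal {n} S =
  Σ (Sub n) λ T → Σ (Elem n) λ x → IsTransversal T × mem T x ≡ true × S ≡ del x T

IsAlmost : ∀ {n} → Sub n → Set
IsAlmost {n} X =
  size X ≡ n × (∃[ i ] (pairCount X i ≡ 2 × (∀ j → pairCount X j ≡ 2 → j ≡ i)))

odd : ℕ → Bool
odd zero    = false
odd (suc k) = not (odd k)

starCount : ∀ {n} → Sub n → ℕ
starCount X = countᵇ proj₂ X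

InTσ : ∀ {n} → Bool → Sub n → Set
InTσ σ T = IsTransversal T × odd (starCount T) ≡ σ

bit : Bool → ℕ
bit true  = 1
bit false = 0

-- Restricted Grassmann–Plücker functions.  φ is given on all subsets,
-- but only its values on T_n ∪ A_n are constrained / used.

module _ (F : Tract) where
  open Tract F

  sign : ℕ → Carrier
  sign zero    = one
  sign (suc k) = minus1 · sign k

  gp2Sum : ∀ {n} → (Sub n → Carrier) → Sub n → Sub n → List Carrier
  gp2Sum φ S S' =
    map (λ x → sign (countBelow (S △ S') x) · (φ (del x S) · φ (ins x S')))
        (elems (S ∖ S'))

  record IsRGP (n : ℕ) (φ : Sub n → Carrier) : Set where
    field
      nonzero : ∃[ X ] ((IsTransversal X ⊎ IsAlmost X) × φ X ≢ zero#)
      rGP2    : ∀ S S' → IsHyperTransversal S → IsHypoTransversal S' → N (gp2Sum φ S S')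
      σ       : Bool
      rGP3    : ∀ T → InTσ (not σ) T → φ T ≡ zero#
      rGP4    : ∀ B (i j : Fin n) → InTσ σ B → i ≢ j →
                φ (ins (j , false) (ins (j , true) (del (i , false) (del (i , true) B))))
                ≡ sign (bit (mem B (i , false)) + bit (mem B (j , false)))
                  · φ (del (j , false) (del (j , true) (ins (i , false) (ins (i , true) B))))

  XS : ∀ {n} → (Sub n → Carrier) → Sub n → Elem n → Carrier
  XS φ S k = if mem S k then sign (countBelow S k) · φ (del k S) else zero#

  YS' : ∀ {n} → (Sub n → Carrier) → Sub n → Elem n → Carrier
  YS' φ S' k = if mem S' (star k) then zero# else sign (countBelow S' (star k)) · φ (ins (star k) S')

{-# OPTIONS --safe #-}
module Submission where

-- Write S' = S ∖ {i, i*} and B c = S' ∪ {(i , c)}, so B false ∋ i and B true ∋ i*. Their numbers of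
-- starred elements differ by one, so by (rGP3) φ vanishes on one of them while the other, B c, lies
-- in T^σ; the sign relating Y_S' to X_S will be (-1)^[c = false].
-- For k ∈ {i, i*}, X_S(k) and Y_S'(k) are multiples of φ(S ∖ {k}) with ratio (-1)^[k = i*]; this is
-- the claimed sign when S ∖ {k} = B c, and both vanish otherwise.
-- For any other k ∈ S, (rGP4) for B c and the indices of i and k gives
-- φ(S' ∪ {k*}) = (-1)^([i ∈ B c] + [k unstarred]) φ(S ∖ {k}), while |S' < k*| + [k unstarred]
-- ≡ |S' < k| ≡ |S < k| (mod 2) because i and i* lie on the same side of k.
-- For k ∉ S we have k* ∈ S', and both sides vanish.

open import Defs
open import Data.Bool using (Bool; true; false; not; _∧_; _∨_; if_then_else_; T)
open import Data.Bool.Properties using (∧-zeroʳ; ∧-identityʳ; ∨-identityʳ; not-involutive)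
open import Data.Fin using (Fin; zero; suc; toℕ)
open import Data.Fin.Properties using (_≟_; toℕ-injective; suc-injective)
open import Data.List using ([]; _∷_; map; concatMap)
open import Data.List.Properties using (map-cong; map-∘)
open import Data.Nat using (ℕ; zero; suc; _+_; _<ᵇ_; _≡ᵇ_)
open import Data.Nat.ListAction using (sum)
open import Data.Nat.Properties using (+-assoc; +-comm; +-identityʳ; +-suc; ≡ᵇ⇒≡)
open import Data.Product using (Σ; _×_; _,_; proj₁; proj₂)
open import Data.Sum using (_⊎_; inj₁; inj₂)
import Data.Vec as Vec
open import Data.Vec using (Vec; _∷_; lookup; updateAt; _[_]≔_; toList; allFin; tabulate; countᵇ)
open import Data.Vec.Properties
  using (updateAt-updateAt; updateAt-cong-local; updateAt-id-local; lookup∘update; lookup∘update′;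
         lookup∘updateAt′; tabulate-allFin; toList-map)
open import Data.List.Relation.Binary.Permutation.Propositional using (swap; ↭-refl)
open import Function using (_∘_)
open import Function.Bundles using (Equivalence)
open import Relation.Binary.PropositionalEquality
open import Relation.Nullary using (yes; no; contradiction)

-- In this notation (rGP4) relates φ (fill j (clear i B)) to φ (clear j (fill i B)).
clear : ∀ {n} → Fin n → Sub n → Sub n
clear i X = del (i , false) (del (i , true) X)

fill : ∀ {n} → Fin n → Sub n → Sub n
fill i X = ins (i , false) (ins (i , true) X)

module _ {n : ℕ} where

  clear-≔ : ∀ (i : Fin n) X → clear i X ≡ X [ i ]≔ (false , false)
  clear-≔ i X = updateAt-updateAt i X

  ins-clear-≔ : ∀ (i : Fin n) c X →
                ins (i , c) (clear i X) ≡ X [ i ]≔ setBit c true (false , false)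
  ins-clear-≔ i c X = trans (updateAt-updateAt i _) (updateAt-updateAt i X)

  clear-updateAt : ∀ (i : Fin n) {f} X → clear i (updateAt X i f) ≡ clear i X
  clear-updateAt i X = trans (clear-≔ i _) (trans (updateAt-updateAt i X) (sym (clear-≔ i X)))

  clear-clear : ∀ (i : Fin n) X → clear i (clear i X) ≡ clear i X
  clear-clear i X = trans (clear-updateAt i _) (clear-updateAt i X)

  fill-updateAt : ∀ (i : Fin n) {f} X → fill i (updateAt X i f) ≡ fill i X
  fill-updateAt i X =
    trans (updateAt-updateAt i _) (trans (updateAt-updateAt i X) (sym (updateAt-updateAt i X)))

  fill-clear : ∀ (i : Fin n) X → fill i (clear i X) ≡ fill i X
  fill-clear i X = trans (fill-updateAt i _) (fill-updateAt i X)

  fill-id : ∀ (i : Fin n) X → mem X (i , false) ≡ true → mem X (i , true) ≡ true → fill i X ≡ X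
  fill-id i X i∈X i*∈X =
    trans (updateAt-updateAt i X) (updateAt-id-local i X (cong₂ _,_ (sym i∈X) (sym i*∈X)))

  fill≡ins : ∀ (i : Fin n) X b → mem X (i , b) ≡ true → fill i X ≡ ins (i , not b) X
  fill≡ins i X false x∈X =
    trans (updateAt-updateAt i X) (updateAt-cong-local i X (cong (_, true) (sym x∈X)))
  fill≡ins i X true  x∈X =
    trans (updateAt-updateAt i X) (updateAt-cong-local i X (cong (true ,_) (sym x∈X)))

  clear≡del : ∀ (i : Fin n) X b → mem X (i , not b) ≡ false → clear i X ≡ del (i , b) X
  clear≡del i X false x*∉X = trans (clear-≔ i X) (updateAt-cong-local i X (cong (false ,_) (sym x*∉X)))
  clear≡del i X true  x*∉X = trans (clear-≔ i X) (updateAt-cong-local i X (cong (_, false) (sym x*∉X)))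

  del≡ins-clear : ∀ (i : Fin n) X b → mem X (i , not b) ≡ true →
                  del (i , b) X ≡ ins (i , not b) (clear i X)
  del≡ins-clear i X false x*∈X =
    trans (updateAt-cong-local i X (cong (false ,_) x*∈X)) (sym (ins-clear-≔ i true X))
  del≡ins-clear i X true  x*∈X =
    trans (updateAt-cong-local i X (cong (_, false) x*∈X)) (sym (ins-clear-≔ i false X))

  mem-lookup : ∀ {X Y : Sub n} {m} → lookup X m ≡ lookup Y m → ∀ c → mem X (m , c) ≡ mem Y (m , c)
  mem-lookup eq false = cong proj₁ eq
  mem-lookup eq true  = cong proj₂ eq

  lookup-clear : ∀ (i : Fin n) X → lookup (clear i X) i ≡ (false , false)
  lookup-clear i X = trans (cong (λ Y → lookup Y i) (clear-≔ i X)) (lookup∘update i X _)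

  mem-clear : ∀ (i : Fin n) X c → mem (clear i X) (i , c) ≡ false
  mem-clear i X false = cong proj₁ (lookup-clear i X)
  mem-clear i X true  = cong proj₂ (lookup-clear i X)

  mem-clear-≢ : ∀ (i : Fin n) X {m} → m ≢ i → ∀ c → mem (clear i X) (m , c) ≡ mem X (m , c)
  mem-clear-≢ i X m≢i =
    mem-lookup (trans (cong (λ Y → lookup Y _) (clear-≔ i X)) (lookup∘update′ m≢i X _))

pairSize : Bool × Bool → ℕ
pairSize (a , b) = (if a then 1 else 0) + (if b then 1 else 0)

pairCount-lookup : ∀ {n} {X Y : Sub n} {m} → lookup X m ≡ lookup Y m →
                   pairCount X m ≡ pairCount Y m
pairCount-lookup = cong pairSize

hyperTransversal-pairCount : ∀ {n} {S : Sub n} {i} → IsHyperTransversal S → pairCount S i ≡ 2 →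
                             ∀ m → m ≢ i → pairCount S m ≡ 1
hyperTransversal-pairCount {i = i} (T , (p , c) , T-transversal , _ , refl) Si≡2 m m≢i with m ≟ p
... | no m≢p =
  trans (pairCount-lookup {X = ins (p , c) T} {T} (lookup∘updateAt′ m p m≢p T)) (T-transversal m)
... | yes refl = contradiction (trans (sym Si≡2) Si≡1) λ ()
  where
  Si≡1 : pairCount (ins (m , c) T) i ≡ 1
  Si≡1 = trans (pairCount-lookup {X = ins (m , c) T} {T} (lookup∘updateAt′ i m (m≢i ∘ sym) T))
               (T-transversal i)

transversal-star : ∀ {n} (X : Sub n) m b → pairCount X m ≡ 1 →
                   mem X (m , not b) ≡ not (mem X (m , b))
transversal-star X m false one = exactly-one (lookup X m) one
  where
  exactly-one : ∀ p → pairSize p ≡ 1 → proj₂ p ≡ not (proj₁ p)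
  exactly-one (true  , true ) ()
  exactly-one (true  , false) _ = refl
  exactly-one (false , true ) _ = refl
  exactly-one (false , false) ()
transversal-star X m true one =
  trans (sym (not-involutive _)) (cong not (sym (transversal-star X m false one)))

countᵇ-[]≔ : ∀ {A : Set} {n} (P : A → Bool) (xs : Vec A n) i {x y} →
             P x ≡ true → P y ≡ false → countᵇ P (xs [ i ]≔ x) ≡ suc (countᵇ P (xs [ i ]≔ y))
countᵇ-[]≔ P (z ∷ xs) zero    Px Py rewrite Px | Py = refl
countᵇ-[]≔ P (z ∷ xs) (suc i) Px Py with P z
... | true  = cong suc (countᵇ-[]≔ P xs i Px Py)
... | false = countᵇ-[]≔ P xs i Px Py

parity-choice : ∀ (s : Bool → ℕ) → s true ≡ suc (s false) →
                ∀ σ → Σ Bool λ c → odd (s c) ≡ σ × odd (s (not c)) ≡ not σ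
parity-choice s step σ = choose σ (odd (s false)) refl
  where
  choose : ∀ σ p → odd (s false) ≡ p → Σ Bool λ c → odd (s c) ≡ σ × odd (s (not c)) ≡ not σ
  choose false false s₀ = false , s₀ , trans (cong odd step) (cong not s₀)
  choose true  true  s₀ = false , s₀ , trans (cong odd step) (cong not s₀)
  choose true  false s₀ = true  , trans (cong odd step) (cong not s₀) , s₀
  choose false true  s₀ = true  , trans (cong odd step) (cong not s₀) , s₀

<ᵇ-irrefl : ∀ a → (a <ᵇ a) ≡ false
<ᵇ-irrefl zero    = refl
<ᵇ-irrefl (suc a) = <ᵇ-irrefl a

≡ᵇ-refl : ∀ a → (a ≡ᵇ a) ≡ true
≡ᵇ-refl zero    = refl
≡ᵇ-refl (suc a) = ≡ᵇ-refl a

<E-diag : ∀ {n} (m : Fin n) c b → ((m , c) <E (m , b)) ≡ (not c ∧ b)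
<E-diag m c b = cong₂ _∨_ (<ᵇ-irrefl (toℕ m)) (cong (_∧ (not c ∧ b)) (≡ᵇ-refl (toℕ m)))

<E-≢ : ∀ {n} {m j : Fin n} c b → m ≢ j → ((m , c) <E (j , b)) ≡ (toℕ m <ᵇ toℕ j)
<E-≢ {m = m} {j} c b m≢j with toℕ m ≡ᵇ toℕ j in eq
... | true  = contradiction (toℕ-injective (≡ᵇ⇒≡ (toℕ m) (toℕ j) (subst T (sym eq) _))) m≢j
... | false = ∨-identityʳ _

sumFin : ∀ {n} → (Fin n → ℕ) → ℕ
sumFin {n} g = sum (map g (toList (allFin n)))

sumFin-cong : ∀ {n} {g h : Fin n → ℕ} → (∀ m → g m ≡ h m) → sumFin g ≡ sumFin h
sumFin-cong {n} g≗h = cong sum (map-cong g≗h (toList (allFin n)))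

sumFin-suc : ∀ {n} (g : Fin (suc n) → ℕ) → sumFin g ≡ g zero + sumFin (g ∘ suc)
sumFin-suc {n} g = cong (λ xs → g zero + sum xs) (begin
  map g (toList (tabulate suc))             ≡⟨ cong (map g ∘ toList) (tabulate-allFin suc) ⟩
  map g (toList (Vec.map suc (allFin n)))   ≡⟨ cong (map g) (toList-map suc (allFin n)) ⟩
  map g (map suc (toList (allFin n)))       ≡⟨ map-∘ _ ⟨
  map (g ∘ suc) (toList (allFin n))         ∎)
  where open ≡-Reasoning

sumFin-point : ∀ {n} (g h : Fin n → ℕ) j → (∀ m → m ≢ j → g m ≡ h m) →
               sumFin g + h j ≡ sumFin h + g j
sumFin-point g h zero agree = begin
  sumFin g + h zero                     ≡⟨ cong (_+ h zero) (sumFin-suc g) ⟩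
  (g zero + sumFin (g ∘ suc)) + h zero  ≡⟨ cong (λ s → (g zero + s) + h zero) rest ⟩
  (g zero + sumFin (h ∘ suc)) + h zero  ≡⟨ +-comm _ (h zero) ⟩
  h zero + (g zero + sumFin (h ∘ suc))  ≡⟨ cong (h zero +_) (+-comm (g zero) _) ⟩
  h zero + (sumFin (h ∘ suc) + g zero)  ≡⟨ +-assoc (h zero) _ _ ⟨
  (h zero + sumFin (h ∘ suc)) + g zero  ≡⟨ cong (_+ g zero) (sumFin-suc h) ⟨
  sumFin h + g zero                     ∎
  where
  open ≡-Reasoning
  rest : sumFin (g ∘ suc) ≡ sumFin (h ∘ suc)
  rest = sumFin-cong (λ m → agree (suc m) λ ())
sumFin-point g h (suc j) agree = begin
  sumFin g + h (suc j)                            ≡⟨ cong (_+ h (suc j)) (sumFin-suc g) ⟩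
  (g zero + sumFin (g ∘ suc)) + h (suc j)         ≡⟨ +-assoc (g zero) _ _ ⟩
  g zero + (sumFin (g ∘ suc) + h (suc j))         ≡⟨ cong₂ _+_ (agree zero λ ()) rest ⟩
  h zero + (sumFin (h ∘ suc) + g (suc j))         ≡⟨ +-assoc (h zero) _ _ ⟨
  (h zero + sumFin (h ∘ suc)) + g (suc j)         ≡⟨ cong (_+ g (suc j)) (sumFin-suc h) ⟨
  sumFin h + g (suc j)                            ∎
  where
  open ≡-Reasoning
  rest : sumFin (g ∘ suc) + h (suc j) ≡ sumFin (h ∘ suc) + g (suc j)
  rest = sumFin-point (g ∘ suc) (h ∘ suc) j (λ m m≢j → agree (suc m) (m≢j ∘ suc-injective))

module _ {n : ℕ} where

  below : Sub n → Elem n → Elem n → ℕ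
  below X k x = if mem X x ∧ (x <E k) then 1 else 0

  countAt : Sub n → Elem n → Fin n → ℕ
  countAt X k m = below X k (m , false) + below X k (m , true)

  below-≡ : ∀ X k x {a l} → mem X x ≡ a → (x <E k) ≡ l → below X k x ≡ bit (a ∧ l)
  below-≡ X k x {a} {l} refl refl with a ∧ l
  ... | true  = refl
  ... | false = refl

  countAt-cong : ∀ X Y k k' m → (∀ c → mem X (m , c) ≡ mem Y (m , c)) →
                 (∀ c → ((m , c) <E k) ≡ ((m , c) <E k')) → countAt X k m ≡ countAt Y k' m
  countAt-cong X Y k k' m X≗Y k≗k' = cong₂ _+_ (below-cong false) (below-cong true)
    where
    below-cong : ∀ c → below X k (m , c) ≡ below Y k' (m , c)
    below-cong c = cong₂ (λ a l → if a ∧ l then 1 else 0) (X≗Y c) (k≗k' c)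

  countAt-diag : ∀ X m b → countAt X (m , b) m ≡ bit (b ∧ mem X (m , false))
  countAt-diag X m false = cong₂ _+_ (strictly-below false) (strictly-below true)
    where
    strictly-below : ∀ c → below X (m , false) (m , c) ≡ 0
    strictly-below c =
      trans (below-≡ X (m , false) (m , c) refl (trans (<E-diag m c false) (∧-zeroʳ (not c))))
            (cong bit (∧-zeroʳ _))
  countAt-diag X m true = begin
    below X (m , true) (m , false) + below X (m , true) (m , true)
      ≡⟨ cong₂ _+_ (below-≡ X (m , true) (m , false) refl (<E-diag m false true))
                   (below-≡ X (m , true) (m , true) refl (<E-diag m true true)) ⟩
    bit (mem X (m , false) ∧ true) + bit (mem X (m , true) ∧ false)
      ≡⟨ cong₂ (λ a b → bit a + bit b) (∧-identityʳ _) (∧-zeroʳ _) ⟩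
    bit (mem X (m , false)) + 0
      ≡⟨ +-identityʳ _ ⟩
    bit (mem X (m , false)) ∎
    where open ≡-Reasoning

  countBelow≡sumFin : ∀ X k → countBelow X k ≡ sumFin (countAt X k)
  countBelow≡sumFin X k = sum-pairs (toList (allFin n))
    where
    sum-pairs : ∀ ms → sum (map (below X k) (concatMap (λ m → (m , false) ∷ (m , true) ∷ []) ms))
                       ≡ sum (map (countAt X k) ms)
    sum-pairs []       = refl
    sum-pairs (m ∷ ms) =
      trans (sym (+-assoc (below X k (m , false)) _ _)) (cong (countAt X k m +_) (sum-pairs ms))

  countAt-clear : ∀ X i k → countAt (clear i X) k i ≡ 0
  countAt-clear X i k = cong₂ _+_ (below-≡ (clear i X) k (i , false) (mem-clear i X false) refl)
                                  (below-≡ (clear i X) k (i , true) (mem-clear i X true) refl)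

  countBelow-local : ∀ X Y k k' j → (∀ m → m ≢ j → countAt X k m ≡ countAt Y k' m) →
                     countAt Y k' j ≡ 0 → countBelow X k ≡ countBelow Y k' + countAt X k j
  countBelow-local X Y k k' j agree Y-vanishes = begin
    countBelow X k                         ≡⟨ countBelow≡sumFin X k ⟩
    sumFin (countAt X k)                   ≡⟨ +-identityʳ _ ⟨
    sumFin (countAt X k) + 0               ≡⟨ cong (sumFin (countAt X k) +_) Y-vanishes ⟨
    sumFin (countAt X k) + countAt Y k' j  ≡⟨ sumFin-point _ _ j agree ⟩
    sumFin (countAt Y k') + countAt X k j  ≡⟨ cong (_+ countAt X k j) (countBelow≡sumFin Y k') ⟨
    countBelow Y k' + countAt X k j        ∎
    where open ≡-Reasoning

  countBelow-star : ∀ X m → countBelow X (m , true) ≡ countBelow X (m , false) + bit (mem X (m , false))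
  countBelow-star X m = trans (countBelow-local X X (m , true) (m , false) m agree (countAt-diag X m false))
                              (cong (countBelow X (m , false) +_) (countAt-diag X m true))
    where
    agree : ∀ m' → m' ≢ m → countAt X (m , true) m' ≡ countAt X (m , false) m'
    agree m' m'≢m = countAt-cong X X (m , true) (m , false) m' (λ _ → refl)
                      (λ c → trans (<E-≢ c true m'≢m) (sym (<E-≢ c false m'≢m)))

  countBelow-clear-diag : ∀ X i c → countBelow (clear i X) (i , c) ≡ countBelow X (i , false)
  countBelow-clear-diag X i c =
    trans (countBelow-local (clear i X) X (i , c) (i , false) i agree (countAt-diag X i false))
          (trans (cong (countBelow X (i , false) +_) (countAt-clear X i (i , c))) (+-identityʳ _))
    where
    agree : ∀ m → m ≢ i → countAt (clear i X) (i , c) m ≡ countAt X (i , false) m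
    agree m m≢i = countAt-cong (clear i X) X (i , c) (i , false) m (mem-clear-≢ i X m≢i)
                    (λ c' → trans (<E-≢ c' c m≢i) (sym (<E-≢ c' false m≢i)))

  countBelow-clear : ∀ X i m b → mem X (i , false) ≡ true → mem X (i , true) ≡ true → m ≢ i →
                     let t = bit (toℕ i <ᵇ toℕ m) in
                     countBelow X (m , b) ≡ countBelow (clear i X) (m , b) + (t + t)
  countBelow-clear X i m b i∈X i*∈X m≢i =
    trans (countBelow-local X (clear i X) (m , b) (m , b) i agree (countAt-clear X i (m , b)))
          (cong (countBelow (clear i X) (m , b) +_) (cong₂ _+_ (present false i∈X) (present true i*∈X)))
    where
    present : ∀ c → mem X (i , c) ≡ true → below X (m , b) (i , c) ≡ bit (toℕ i <ᵇ toℕ m)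
    present c i∈X = below-≡ X (m , b) (i , c) i∈X (<E-≢ c b (m≢i ∘ sym))
    agree : ∀ m' → m' ≢ i → countAt X (m , b) m' ≡ countAt (clear i X) (m , b) m'
    agree m' m'≢i =
      countAt-cong X (clear i X) (m , b) (m , b) m' (λ c → sym (mem-clear-≢ i X m'≢i c)) (λ _ → refl)

module TractProperties (F : Tract) where
  open Tract F

  ·-identityʳ : ∀ x → x · one ≡ x
  ·-identityʳ x = trans (·-comm x one) (·-identityˡ x)

  ·-zeroʳ : ∀ x → x · zero# ≡ zero#
  ·-zeroʳ x = trans (·-comm x zero#) (·-zeroˡ x)

  ·-exchange : ∀ x y z → x · (y · z) ≡ y · (x · z)
  ·-exchange x y z = trans (sym (·-assoc x y z)) (trans (cong (_· z) (·-comm x y)) (·-assoc y x z))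

  minus1≢zero : minus1 ≢ zero#
  minus1≢zero -1≡0 = one≢zero (N-single one (Equivalence.to (N-zero (one ∷ [])) 0+1∈N))
    where
    0+1∈N : N (zero# ∷ one ∷ [])
    0+1∈N = N-perm (swap one zero# ↭-refl) (subst (λ x → N (one ∷ x ∷ [])) -1≡0 N-minus1)

  -- The inverse y of -1 satisfies y · (1 + (-1)) = y + 1 ∈ N, so y = -1 by uniqueness.
  minus1²≡one : minus1 · minus1 ≡ one
  minus1²≡one with ·-inverse minus1 minus1≢zero
  ... | y , -1·y≡1 = trans (cong (minus1 ·_) (sym y≡-1)) -1·y≡1
    where
    y≢zero : y ≢ zero#
    y≢zero y≡0 = one≢zero (trans (sym -1·y≡1) (trans (cong (minus1 ·_) y≡0) (·-zeroʳ minus1)))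
    y+1∈N : N (y ∷ one ∷ [])
    y+1∈N = subst₂ (λ a b → N (a ∷ b ∷ [])) (·-identityʳ y) (trans (·-comm y minus1) -1·y≡1)
                   (N-scale y (one ∷ minus1 ∷ []) y≢zero N-minus1)
    y≡-1 : y ≡ minus1
    y≡-1 = minus1-unique y (N-perm (swap y one ↭-refl) y+1∈N)

  sign-+ : ∀ a b → sign F (a + b) ≡ sign F a · sign F b
  sign-+ zero    b = sym (·-identityˡ (sign F b))
  sign-+ (suc a) b = trans (cong (minus1 ·_) (sign-+ a b)) (sym (·-assoc minus1 (sign F a) (sign F b)))

  sign-double : ∀ t → sign F (t + t) ≡ one
  sign-double zero    = refl
  sign-double (suc t) = begin
    minus1 · sign F (t + suc t)            ≡⟨ cong (λ s → minus1 · sign F s) (+-suc t t) ⟩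
    minus1 · (minus1 · sign F (t + t))     ≡⟨ ·-assoc minus1 minus1 _ ⟨
    (minus1 · minus1) · sign F (t + t)     ≡⟨ cong₂ _·_ minus1²≡one (sign-double t) ⟩
    one · one                              ≡⟨ ·-identityˡ one ⟩
    one                                    ∎
    where open ≡-Reasoning

  sign-+-double : ∀ a t → sign F (a + (t + t)) ≡ sign F a
  sign-+-double a t =
    trans (sign-+ a (t + t)) (trans (cong (sign F a ·_) (sign-double t)) (·-identityʳ _))

  sign-exchange : ∀ a s d x → sign F a · (sign F (s + d) · x) ≡ sign F s · (sign F (a + d) · x)
  sign-exchange a s d x = begin
    sign F a · (sign F (s + d) · x)           ≡⟨ cong (λ e → sign F a · (e · x)) (sign-+ s d) ⟩
    sign F a · ((sign F s · sign F d) · x)    ≡⟨ cong (sign F a ·_) (·-assoc _ _ x) ⟩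
    sign F a · (sign F s · (sign F d · x))    ≡⟨ ·-exchange _ _ _ ⟩
    sign F s · (sign F a · (sign F d · x))    ≡⟨ cong (sign F s ·_) (·-assoc _ _ x) ⟨
    sign F s · ((sign F a · sign F d) · x)    ≡⟨ cong (λ e → sign F s · (e · x)) (sign-+ a d) ⟨
    sign F s · (sign F (a + d) · x)           ∎
    where open ≡-Reasoning

  sign-countBelow-star : ∀ {n} (X : Sub n) m b → mem X (m , false) ≡ not b →
                         sign F (countBelow X (m , not b) + bit (not b)) ≡ sign F (countBelow X (m , b))
  sign-countBelow-star X m false m∈X = begin
    sign F (countBelow X (m , true) + 1)        ≡⟨ cong (λ a → sign F (a + 1)) (countBelow-star X m) ⟩
    sign F ((P + bit (mem X (m , false))) + 1)  ≡⟨ cong (λ a → sign F ((P + bit a) + 1)) m∈X ⟩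
    sign F ((P + 1) + 1)                        ≡⟨ cong (sign F) (+-assoc P 1 1) ⟩
    sign F (P + (1 + 1))                        ≡⟨ sign-+-double P 1 ⟩
    sign F P                                    ∎
    where
    open ≡-Reasoning
    P : ℕ
    P = countBelow X (m , false)
  sign-countBelow-star X m true m∉X =
    cong (sign F) (sym (trans (countBelow-star X m) (cong (λ a → countBelow X (m , false) + bit a) m∉X)))

  XS-∈ : ∀ {n} (φ : Sub n → Carrier) S k → mem S k ≡ true →
         XS F φ S k ≡ sign F (countBelow S k) · φ (del k S)
  XS-∈ φ S k = cong (λ b → if b then sign F (countBelow S k) · φ (del k S) else zero#)

  XS-∉ : ∀ {n} (φ : Sub n → Carrier) S k → mem S k ≡ false → XS F φ S k ≡ zero#
  XS-∉ φ S k = cong (λ b → if b then sign F (countBelow S k) · φ (del k S) else zero#)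

  YS'-∉ : ∀ {n} (φ : Sub n → Carrier) S' k → mem S' (star k) ≡ false →
          YS' F φ S' k ≡ sign F (countBelow S' (star k)) · φ (ins (star k) S')
  YS'-∉ φ S' k = cong (λ b → if b then zero# else sign F (countBelow S' (star k)) · φ (ins (star k) S'))

  YS'-∈ : ∀ {n} (φ : Sub n → Carrier) S' k → mem S' (star k) ≡ true → YS' F φ S' k ≡ zero#
  YS'-∈ φ S' k = cong (λ b → if b then zero# else sign F (countBelow S' (star k)) · φ (ins (star k) S'))

module SkewPair (F : Tract) {n} (φ : Sub n → Tract.Carrier F) (rgp : IsRGP F n φ)
                (S : Sub n) (i : Fin n) (hyper : IsHyperTransversal S)
                (i∈S : mem S (i , false) ≡ true) (i*∈S : mem S (i , true) ≡ true) where
  open Tract F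
  open IsRGP rgp
  open TractProperties F

  S' : Sub n
  S' = clear i S

  B : Bool → Sub n
  B c = ins (i , c) S'

  pair∈S : ∀ c → mem S (i , c) ≡ true
  pair∈S false = i∈S
  pair∈S true  = i*∈S

  S-transversal-off : ∀ m → m ≢ i → pairCount S m ≡ 1
  S-transversal-off = hyperTransversal-pairCount hyper (cong pairSize (cong₂ _,_ i∈S i*∈S))

  lookup-B : ∀ c → lookup (B c) i ≡ setBit c true (false , false)
  lookup-B c = trans (cong (λ X → lookup X i) (ins-clear-≔ i c S)) (lookup∘update i S _)

  lookup-B-≢ : ∀ c {m} → m ≢ i → lookup (B c) m ≡ lookup S m
  lookup-B-≢ c m≢i = trans (cong (λ X → lookup X _) (ins-clear-≔ i c S)) (lookup∘update′ m≢i S _)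

  B-transversal : ∀ c → IsTransversal (B c)
  B-transversal c m with m ≟ i
  ... | yes refl = trans (cong pairSize (lookup-B c)) (singleton c)
    where
    singleton : ∀ c → pairSize (setBit c true (false , false)) ≡ 1
    singleton false = refl
    singleton true  = refl
  ... | no m≢i =
    trans (pairCount-lookup {X = B c} {S} (lookup-B-≢ c m≢i)) (S-transversal-off m m≢i)

  mem-B : ∀ c → mem (B c) (i , false) ≡ not c
  mem-B false = cong proj₁ (lookup-B false)
  mem-B true  = cong proj₁ (lookup-B true)

  starCount-B : starCount (B true) ≡ suc (starCount (B false))
  starCount-B = begin
    starCount (B true)                         ≡⟨ cong starCount (ins-clear-≔ i true S) ⟩
    starCount (S [ i ]≔ (false , true))        ≡⟨ countᵇ-[]≔ proj₂ S i refl refl ⟩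
    suc (starCount (S [ i ]≔ (true , false)))  ≡⟨ cong (suc ∘ starCount) (ins-clear-≔ i false S) ⟨
    suc (starCount (B false))                  ∎
    where open ≡-Reasoning

  σ-choice : Σ Bool λ c → InTσ σ (B c) × φ (B (not c)) ≡ zero#
  σ-choice with parity-choice (starCount ∘ B) starCount-B σ
  ... | c , Bc-σ , B¬c-¬σ =
    c , (B-transversal c , Bc-σ) , rGP3 (B (not c)) (B-transversal (not c) , B¬c-¬σ)

  XS-at-i : ∀ b → XS F φ S (i , b) ≡ sign F (countBelow S (i , false) + bit b) · φ (B (not b))
  XS-at-i b = trans (XS-∈ φ S (i , b) (pair∈S b))
                    (cong₂ (λ a X → sign F a · φ X) (count b) (del≡ins-clear i S b (pair∈S (not b))))
    where
    count : ∀ b → countBelow S (i , b) ≡ countBelow S (i , false) + bit b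
    count false = sym (+-identityʳ _)
    count true  = trans (countBelow-star S i) (cong (λ a → countBelow S (i , false) + bit a) i∈S)

  Y≡±X-at-i : ∀ b → YS' F φ S' (i , b) ≡ sign F (bit b) · XS F φ S (i , b)
  Y≡±X-at-i b = begin
    YS' F φ S' (i , b)                           ≡⟨ YS'-∉ φ S' (i , b) (mem-clear i S (not b)) ⟩
    sign F (countBelow S' (i , not b)) · Φ
      ≡⟨ cong (λ a → sign F a · Φ) (countBelow-clear-diag S i (not b)) ⟩
    sign F a · Φ                                 ≡⟨ cong (sign F a ·_) (·-identityˡ Φ) ⟨
    sign F a · (one · Φ)
      ≡⟨ cong (λ e → sign F a · (e · Φ)) (sign-double (bit b)) ⟨
    sign F a · (sign F (bit b + bit b) · Φ)      ≡⟨ sign-exchange a (bit b) (bit b) Φ ⟩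
    sign F (bit b) · (sign F (a + bit b) · Φ)    ≡⟨ cong (sign F (bit b) ·_) (XS-at-i b) ⟨
    sign F (bit b) · XS F φ S (i , b)            ∎
    where
    open ≡-Reasoning
    a : ℕ
    a = countBelow S (i , false)
    Φ : Carrier
    Φ = φ (B (not b))

  XS-at-i-vanishes : ∀ b → φ (B (not b)) ≡ zero# → XS F φ S (i , b) ≡ zero#
  XS-at-i-vanishes b φ0 = trans (XS-at-i b) (trans (cong (_ ·_) φ0) (·-zeroʳ _))

  Y≡X-at-i-vanishing : ∀ b → φ (B (not b)) ≡ zero# →
                       YS' F φ S' (i , b) ≡ sign F (bit (not b)) · XS F φ S (i , b)
  Y≡X-at-i-vanishing b φ0 = begin
    YS' F φ S' (i , b)                       ≡⟨ Y≡±X-at-i b ⟩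
    sign F (bit b) · XS F φ S (i , b)        ≡⟨ cong (sign F (bit b) ·_) (XS-at-i-vanishes b φ0) ⟩
    sign F (bit b) · zero#                   ≡⟨ ·-zeroʳ _ ⟩
    zero#                                    ≡⟨ ·-zeroʳ _ ⟨
    sign F (bit (not b)) · zero#             ≡⟨ cong (_ ·_) (XS-at-i-vanishes b φ0) ⟨
    sign F (bit (not b)) · XS F φ S (i , b)  ∎
    where open ≡-Reasoning

  Y≡X-at-i : ∀ c → φ (B (not c)) ≡ zero# → ∀ b →
             YS' F φ S' (i , b) ≡ sign F (bit (not c)) · XS F φ S (i , b)
  Y≡X-at-i false _  true  = Y≡±X-at-i true
  Y≡X-at-i true  _  false = Y≡±X-at-i false
  Y≡X-at-i false φ0 false = Y≡X-at-i-vanishing false φ0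
  Y≡X-at-i true  φ0 true  = Y≡X-at-i-vanishing true φ0

  module _ (c : Bool) (Bc-σ : InTσ σ (B c)) {m : Fin n} (m≢i : m ≢ i) (b : Bool)
           (k∈S : mem S (m , b) ≡ true) where

    k*∉S : mem S (m , not b) ≡ false
    k*∉S = trans (transversal-star S m b (S-transversal-off m m≢i)) (cong not k∈S)

    m∈S≡¬b : mem S (m , false) ≡ not b
    m∈S≡¬b = lemma b k∈S k*∉S
      where
      lemma : ∀ b → mem S (m , b) ≡ true → mem S (m , not b) ≡ false → mem S (m , false) ≡ not b
      lemma false k∈S _    = k∈S
      lemma true  _   k*∉S = k*∉S

    exchange : φ (ins (m , not b) S') ≡ sign F (bit (not c) + bit (not b)) · φ (del (m , b) S)
    exchange = begin
      φ (ins (m , not b) S')                       ≡⟨ cong φ fill-clear-B ⟨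
      φ (fill m (clear i (B c)))                   ≡⟨ rGP4 (B c) i m Bc-σ (m≢i ∘ sym) ⟩
      sign F (bit (mem (B c) (i , false)) + bit (mem (B c) (m , false))) · φ (clear m (fill i (B c)))
        ≡⟨ cong₂ (λ e X → sign F e · φ X) (cong₂ (λ x y → bit x + bit y) (mem-B c) m∈B≡¬b)
                 clear-fill-B ⟩
      sign F (bit (not c) + bit (not b)) · φ (del (m , b) S) ∎
      where
      open ≡-Reasoning
      m∈B≡¬b : mem (B c) (m , false) ≡ not b
      m∈B≡¬b = trans (mem-lookup {X = B c} {Y = S} (lookup-B-≢ c m≢i) false) m∈S≡¬b
      fill-clear-B : fill m (clear i (B c)) ≡ ins (m , not b) S'
      fill-clear-B = trans (cong (fill m) (trans (clear-updateAt i S') (clear-clear i S)))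
                           (fill≡ins m S' b (trans (mem-clear-≢ i S m≢i b) k∈S))
      fill-B : fill i (B c) ≡ S
      fill-B = trans (fill-updateAt i S') (trans (fill-clear i S) (fill-id i S i∈S i*∈S))
      clear-fill-B : clear m (fill i (B c)) ≡ del (m , b) S
      clear-fill-B = trans (cong (clear m) fill-B) (clear≡del m S b k*∉S)

    sign-parity : sign F (countBelow S' (m , not b) + bit (not b)) ≡ sign F (countBelow S (m , b))
    sign-parity = begin
      sign F (countBelow S' (m , not b) + bit (not b))
        ≡⟨ sign-countBelow-star S' m b (trans (mem-clear-≢ i S m≢i false) m∈S≡¬b) ⟩
      sign F (countBelow S' (m , b))                    ≡⟨ sign-+-double (countBelow S' (m , b)) t ⟨
      sign F (countBelow S' (m , b) + (t + t))
        ≡⟨ cong (sign F) (countBelow-clear S i m b i∈S i*∈S m≢i) ⟨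
      sign F (countBelow S (m , b))                     ∎
      where
      open ≡-Reasoning
      t : ℕ
      t = bit (toℕ i <ᵇ toℕ m)

    Y≡X-∈ : YS' F φ S' (m , b) ≡ sign F (bit (not c)) · XS F φ S (m , b)
    Y≡X-∈ = begin
      YS' F φ S' (m , b)                              ≡⟨ YS'-∉ φ S' (m , b) k*∉S' ⟩
      sign F A · φ (ins (m , not b) S')               ≡⟨ cong (sign F A ·_) exchange ⟩
      sign F A · (sign F (s + bit (not b)) · Φ)       ≡⟨ sign-exchange A s (bit (not b)) Φ ⟩
      sign F s · (sign F (A + bit (not b)) · Φ)       ≡⟨ cong (λ e → sign F s · (e · Φ)) sign-parity ⟩
      sign F s · (sign F (countBelow S (m , b)) · Φ)  ≡⟨ cong (_ ·_) (XS-∈ φ S (m , b) k∈S) ⟨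
      sign F s · XS F φ S (m , b)                     ∎
      where
      open ≡-Reasoning
      s A : ℕ
      s = bit (not c)
      A = countBelow S' (m , not b)
      Φ : Carrier
      Φ = φ (del (m , b) S)
      k*∉S' : mem S' (m , not b) ≡ false
      k*∉S' = trans (mem-clear-≢ i S m≢i (not b)) k*∉S

  Y≡X-∉ : ∀ s {m} → m ≢ i → ∀ b → mem S (m , b) ≡ false →
          YS' F φ S' (m , b) ≡ s · XS F φ S (m , b)
  Y≡X-∉ s {m} m≢i b k∉S = begin
    YS' F φ S' (m , b)     ≡⟨ YS'-∈ φ S' (m , b) k*∈S' ⟩
    zero#                  ≡⟨ ·-zeroʳ s ⟨
    s · zero#              ≡⟨ cong (s ·_) (XS-∉ φ S (m , b) k∉S) ⟨
    s · XS F φ S (m , b)   ∎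
    where
    open ≡-Reasoning
    k*∈S' : mem S' (m , not b) ≡ true
    k*∈S' = trans (mem-clear-≢ i S m≢i (not b))
                  (trans (transversal-star S m b (S-transversal-off m m≢i)) (cong not k∉S))

  Y≡X : ∀ c → InTσ σ (B c) → φ (B (not c)) ≡ zero# →
        ∀ k → YS' F φ S' k ≡ sign F (bit (not c)) · XS F φ S k
  Y≡X c Bc-σ φ0 (m , b) with m ≟ i
  ... | yes refl = Y≡X-at-i c φ0 b
  ... | no m≢i = by-membership (mem S (m , b)) refl
    where
    by-membership : ∀ x → mem S (m , b) ≡ x →
                    YS' F φ S' (m , b) ≡ sign F (bit (not c)) · XS F φ S (m , b)
    by-membership true  k∈S = Y≡X-∈ c Bc-σ m≢i b k∈S
    by-membership false k∉S = Y≡X-∉ _ m≢i b k∉S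

  Y≡±X : (∀ k → YS' F φ S' k ≡ XS F φ S k) ⊎ (∀ k → YS' F φ S' k ≡ minus1 · XS F φ S k)
  Y≡±X with σ-choice
  ... | true  , Bc-σ , φ0 = inj₁ λ k → trans (Y≡X true Bc-σ φ0 k) (·-identityˡ _)
  ... | false , Bc-σ , φ0 =
    inj₂ λ k → trans (Y≡X false Bc-σ φ0 k) (cong (_· XS F φ S k) (·-identityʳ minus1))

lemma3p26 : (F : Tract) (n : ℕ) (φ : Sub n → Tract.Carrier F) → IsRGP F n φ →
    (S : Sub n) (i : Fin n) → IsHyperTransversal S →
    mem S (i , false) ≡ true → mem S (i , true) ≡ true →
    ((∀ k → YS' F φ (del (i , false) (del (i , true) S)) k ≡ XS F φ S k)
    ⊎ (∀ k → YS' F φ (del (i , false) (del (i , true) S)) k ≡ Tract._·_ F (Tract.minus1 F) (XS F φ S k)))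
lemma3p26 F n φ rgp S i hyper i∈S i*∈S = SkewPair.Y≡±X F φ rgp S i hyper i∈S i*∈S
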